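{- For $k\geq 1$, let $G_k$ be the disjoint union of $k$ copies of the dodecahedral graph. Then $L(I_{8k}(G_k))\geq 17k-1$.
   Context: The dodecahedral graph has vertex set $\{a_1,\dots,a_{10},b_1,\dots,b_{10}\}$ and edges $\{a_i,b_i\},\{a_i,a_{i+1}\},\{b_i,b_{i+2}\}$ for $i=1,\dots,10$ (indices modulo $10$). For a graph $G=(V,E)$, $I_n(G)=\{U\subseteq V:\ \alpha(G[U])<n\}$, where $\alpha$ is the independence number. $\tilde{H}_i$ denotes reduced simplicial homology with real coefficients. For a simplicial complex $X$ on vertex set $V$, $X[U]=\{\sigma\in X:\sigma\subseteq U\}$; $X$ is $d$-Leray if $\tilde{H}_i(X[U])=0$ for all $U\subseteq V$ and all $i\geq d$, and the Leray number $L(X)$ is the minimum such $d$.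
   Formalization: Reduced homology, and with it the Leray number of $I_{8k}(G_k)$, is taken with rational coefficients instead of real coefficients. -}

module Defs where

open import Data.Nat using (ℕ; zero; suc; _<_; _≤_; _*_; _∸_; _<ᵇ_)
open import Data.Nat.DivMod using (_/_; _%_)
open import Data.Fin using (Fin; toℕ)
open import Data.Fin.Subset using (Subset; _∈_; _⊆_; ∣_∣; ⁅_⁆; _∪_)
open import Data.Bool using (Bool; true; false; if_then_else_; _∧_)
open import Data.List using (List; foldr; map; filter; length)
open import Data.List.Base using (allFin)
open import Data.Vec using (lookup)
open import Data.Rational using (ℚ; 0ℚ; _+_; -_)
open import Data.Product using (_×_; Σ-syntax)
open import Relation.Binary.PropositionalEquality using (_≡_; _≢_)
open import Relation.Nullary using (¬_)

Graph : ℕ → Set₁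
Graph N = Fin N → Fin N → Set

-- Dodecahedral graph on {0,…,19}: a_i ↦ i-1, b_i ↦ 10+(i-1).
-- Edges {a_i,b_i}, {a_i,a_{i+1}}, {b_i,b_{i+2}} (indices mod 10).
data DodecaEdge : ℕ → ℕ → Set where
  spoke : ∀ j → j < 10 → DodecaEdge j (10 Data.Nat.+ j)
  outer : ∀ j → j < 10 → DodecaEdge j ((suc j) % 10)
  inner : ∀ j → j < 10 → DodecaEdge (10 Data.Nat.+ j) (10 Data.Nat.+ ((2 Data.Nat.+ j) % 10))

data DodecaAdj (p q : ℕ) : Set where
  fwd : DodecaEdge p q → DodecaAdj p q
  bwd : DodecaEdge q p → DodecaAdj p q

-- G_k: disjoint union of k copies of the dodecahedral graph, vertex x of
-- Fin (k * 20) lies in copy ⌊x/20⌋ and is vertex (x mod 20) of that copy.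
Gk : (k : ℕ) → Graph (k * 20)
Gk k x y = (toℕ x / 20 ≡ toℕ y / 20) × DodecaAdj (toℕ x % 20) (toℕ y % 20)

Independent : ∀ {N} → Graph N → Subset N → Set
Independent G S = ∀ x y → x ∈ S → y ∈ S → ¬ G x y

-- I_n(G) = { U : α(G[U]) < n }, α(G[U]) < n meaning that every independent
-- set of G contained in U has fewer than n elements.
I : ∀ {N} → ℕ → Graph N → Subset N → Set
I n G U = ∀ S → S ⊆ U → Independent G S → ∣ S ∣ < n

-- Reduced simplicial homology with rational coefficients
-- (a complex is given by its membership predicate on subsets of Fin N;
--  faces are oriented by the natural order of Fin N; the empty face is
--  the (-1)-simplex, giving the augmented = reduced chain complex).

Chain : ℕ → Set
Chain N = Subset N → ℚ

sumFin : ∀ {N} → (Fin N → ℚ) → ℚ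
sumFin {N} f = foldr _+_ 0ℚ (map f (allFin N))

below : ∀ {N} → Subset N → Fin N → ℕ
below {N} τ v = length (filter (λ u → Data.Bool._≟_ (lookup τ u ∧ (toℕ u <ᵇ toℕ v)) true) (allFin N))

signed : ℕ → ℚ → ℚ
signed zero q = q
signed (suc m) q = - (signed m q)

∂ : ∀ {N} → Chain N → Chain N
∂ c τ = sumFin (λ v → if lookup τ v then 0ℚ else signed (below τ v) (c (τ ∪ ⁅ v ⁆)))

IsChain : ∀ {N} → (Subset N → Set) → Subset N → ℕ → Chain N → Set
IsChain X U i c = ∀ σ → c σ ≢ 0ℚ → X σ × σ ⊆ U × ∣ σ ∣ ≡ suc i

HomologyVanishes : ∀ {N} → (Subset N → Set) → Subset N → ℕ → Set
HomologyVanishes {N} X U i =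
  ∀ (c : Chain N) → IsChain X U i c → (∀ τ → ∂ c τ ≡ 0ℚ) →
  Σ[ b ∈ Chain N ] (IsChain X U (suc i) b × (∀ τ → ∂ b τ ≡ c τ))

IsLeray : ∀ {N} → (Subset N → Set) → ℕ → Set
IsLeray {N} X d = ∀ (U : Subset N) (i : ℕ) → d ≤ i → HomologyVanishes X U i

-- The dodecahedron D has independence number 8 and exactly five maximum
-- independent sets, found by enumerating all its independent sets. An explicit
-- 16-chain ψ on the vertices of D has its boundary supported on 16-faces
-- containing none of them, so ∂ψ is a cycle of I₈(D); moreover ∂ψ takes the
-- value 1 on a face σ₀ each of whose cofaces contains a maximum independent set.
-- The join ψ^k of k copies of ψ then has a boundary ∂ψ^k that is a
-- (17k-2)-cycle of I₈ₖ(G_k). It is not a boundary there: slicing a chain b of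
-- I₈₍ₖ₊₁₎(G_{k+1}) along σ₀ in the first copy, i.e. taking the boundary of
-- σ ↦ b(σ ++ ρ) at σ₀, gives a chain of I₈ₖ(G_k) (a coface of σ₀ uses up 8 of
-- the allowed independent vertices), slicing commutes with ∂ up to sign, and it
-- sends ψ^(k+1) to ∂ψ(σ₀)·ψ^k = ψ^k; for k = 0 the slice would be a nonzero
-- chain of the empty complex I₀. So H̃_{17k-2}(I₈ₖ(G_k)) ≠ 0.

module Submission where

open import Defs

module Chains where

  open import Algebra.Bundles using (CommutativeRing)
  open import Data.Bool using (Bool; true; false; if_then_else_; _∧_; _∨_; T)
  open import Data.Bool.Properties using (∨-identityʳ; ∨-zeroʳ; ∧-zeroʳ; ¬-not)
  open import Data.Empty using (⊥-elim)
  open import Data.Fin as Fin using (Fin; toℕ; _↑ˡ_; _↑ʳ_)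
  open import Data.Fin.Properties using (toℕ-injective; ¬∀⟶∃¬)
  open import Data.Fin.Subset using (Subset; ⁅_⁆; _∪_; _─_; ∣_∣; ⊥)
  open import Data.Fin.Subset.Properties using (∪-assoc; ∪-comm; ∪-identityʳ; p─⊥≡p; x∈⁅x⁆; x≢y⇒x∉⁅y⁆)
  open import Data.List as List using (foldr; filter; length; tabulate)
  open import Data.Nat as ℕ using (ℕ; zero; suc; _<ᵇ_)
  open import Data.Nat.Properties using (<⇒<ᵇ; <ᵇ⇒<; <-asym; ≤-antisym; ≮⇒≥)
  open import Data.Product using (Σ-syntax; _×_; _,_)
  open import Data.Rational using (ℚ; 0ℚ; ½; _+_; _*_; -_)
  import Data.Rational.Properties as ℚP
  open import Data.Sum using (_⊎_; inj₁; inj₂)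
  open import Data.Vec using ([]; _∷_; lookup; _++_; take; drop)
  open import Data.Vec.Properties
    using (take++drop≡id; ++-injectiveˡ; ++-injectiveʳ; lookup-++ˡ; lookup-++ʳ; lookup-zipWith; []=⇒lookup; lookup⇒[]=)
  open import Function using (_∘_; id)
  open import Relation.Binary.PropositionalEquality
  open import Relation.Nullary using (yes; no)
  open import Algebra.Properties.Group ℚP.+-0-group using (⁻¹-involutive)
  open CommutativeRing ℚP.+-*-commutativeRing using (semiring)
  open import Algebra.Properties.Semiring.Sum semiring using (sum; sum-cong-≗; ∑-distrib-+; ∑-comm; sum-replicate-zero)
  open ≡-Reasoning

  private
    variable
      n m : ℕ

    foldr-+-tabulate : ∀ {A : Set} (f : A → ℚ) (g : Fin n → A) →
                       foldr _+_ 0ℚ (List.map f (tabulate g)) ≡ sum (f ∘ g)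
    foldr-+-tabulate {zero}  f g = refl
    foldr-+-tabulate {suc n} f g = cong (f (g Fin.zero) +_) (foldr-+-tabulate f (g ∘ Fin.suc))

  sumFin≡sum : (f : Fin n → ℚ) → sumFin f ≡ sum f
  sumFin≡sum f = foldr-+-tabulate f id

  sum-nonzero : (f : Fin n → ℚ) → sum f ≢ 0ℚ → Σ[ i ∈ Fin n ] f i ≢ 0ℚ
  sum-nonzero {n} f sum≢0 = ¬∀⟶∃¬ n _ (λ i → f i ℚP.≟ 0ℚ) λ f≗0 →
    sum≢0 (trans (sum-cong-≗ f≗0) (sum-replicate-zero n))

  sum-++ : (f : Fin (n ℕ.+ m) → ℚ) → sum f ≡ sum (f ∘ (_↑ˡ m)) + sum (f ∘ (n ↑ʳ_))
  sum-++ {zero}  f = sym (ℚP.+-identityˡ (sum f))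
  sum-++ {suc n} {m} f = trans (cong (f Fin.zero +_) (sum-++ {n} {m} (f ∘ Fin.suc)))
                           (sym (ℚP.+-assoc (f Fin.zero) _ _))

  *-nonzero : ∀ {p q} → p * q ≢ 0ℚ → p ≢ 0ℚ × q ≢ 0ℚ
  *-nonzero {p} {q} pq≢0 = (λ { refl → pq≢0 (ℚP.*-zeroˡ q) }) , (λ { refl → pq≢0 (ℚP.*-zeroʳ p) })

  +-nonzero : ∀ {p q} → p + q ≢ 0ℚ → p ≢ 0ℚ ⊎ q ≢ 0ℚ
  +-nonzero {p} {q} p+q≢0 with p ℚP.≟ 0ℚ
  ... | no  p≢0  = inj₁ p≢0
  ... | yes refl = inj₂ (λ q≡0 → p+q≢0 (trans (ℚP.+-identityˡ q) q≡0))

  record Additive (h : ℚ → ℚ) : Set where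
    field
      map-0   : h 0ℚ ≡ 0ℚ
      map-+   : ∀ x y → h (x + y) ≡ h x + h y
      map-neg : ∀ x → h (- x) ≡ - h x

    map-sum : (f : Fin n → ℚ) → h (sum f) ≡ sum (h ∘ f)
    map-sum {zero}  f = map-0
    map-sum {suc n} f = trans (map-+ _ _) (cong (h (f Fin.zero) +_) (map-sum (f ∘ Fin.suc)))

    map-signed : ∀ k x → h (signed k x) ≡ signed k (h x)
    map-signed zero    x = refl
    map-signed (suc k) x = trans (map-neg _) (cong -_ (map-signed k x))

  open Additive

  *ˡ-additive : ∀ q → Additive (q *_)
  *ˡ-additive q = record
    { map-0   = ℚP.*-zeroʳ q
    ; map-+   = ℚP.*-distribˡ-+ q
    ; map-neg = λ x → sym (ℚP.neg-distribʳ-* q x)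
    }

  *ʳ-additive : ∀ q → Additive (_* q)
  *ʳ-additive q = record
    { map-0   = ℚP.*-zeroˡ q
    ; map-+   = λ x y → ℚP.*-distribʳ-+ q x y
    ; map-neg = λ x → sym (ℚP.neg-distribˡ-* x q)
    }

  neg-additive : Additive -_
  neg-additive = record
    { map-0   = refl
    ; map-+   = ℚP.neg-distrib-+
    ; map-neg = λ _ → refl
    }

  signed-additive : ∀ k → Additive (signed k)
  signed-additive zero    = record { map-0 = refl ; map-+ = λ _ _ → refl ; map-neg = λ _ → refl }
  signed-additive (suc k) = record
    { map-0   = cong -_ (map-0 (signed-additive k))
    ; map-+   = λ x y → trans (cong -_ (map-+ (signed-additive k) x y))
                              (ℚP.neg-distrib-+ (signed k x) (signed k y))
    ; map-neg = λ x → cong -_ (map-neg (signed-additive k) x)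
    }

  signed-+ : ∀ j k x → signed (j ℕ.+ k) x ≡ signed j (signed k x)
  signed-+ zero    k x = refl
  signed-+ (suc j) k x = cong -_ (signed-+ j k x)

  signed-comm : ∀ j k x → signed j (signed k x) ≡ signed k (signed j x)
  signed-comm j = map-signed (signed-additive j)

  signed-injective : ∀ k {x y} → signed k x ≡ signed k y → x ≡ y
  signed-injective zero    eq = eq
  signed-injective (suc k) eq = signed-injective k (ℚP.neg-injective eq)

  x≡-x⇒x≡0 : ∀ x → x ≡ - x → x ≡ 0ℚ
  x≡-x⇒x≡0 x x≡-x = begin
    x               ≡⟨ ℚP.*-identityˡ x ⟨
    (½ + ½) * x     ≡⟨ ℚP.*-distribʳ-+ x ½ ½ ⟩
    ½ * x + ½ * x   ≡⟨ ℚP.*-distribˡ-+ ½ x x ⟨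
    ½ * (x + x)     ≡⟨ cong (λ y → ½ * (x + y)) x≡-x ⟩
    ½ * (x + - x)   ≡⟨ cong (½ *_) (ℚP.+-inverseʳ x) ⟩
    ½ * 0ℚ          ≡⟨ ℚP.*-zeroʳ ½ ⟩
    0ℚ              ∎

  private
    count : (Fin n → Bool) → ℕ
    count {zero}  p = 0
    count {suc n} p = if p Fin.zero then suc (count (p ∘ Fin.suc)) else count (p ∘ Fin.suc)

    length-filter-tabulate : ∀ {A : Set} (p : A → Bool) (g : Fin n → A) →
      length (filter (λ u → p u Data.Bool.≟ true) (tabulate g)) ≡ count (p ∘ g)
    length-filter-tabulate {zero}  p g = refl
    length-filter-tabulate {suc n} p g with p (g Fin.zero)
    ... | true  = cong suc (length-filter-tabulate p (g ∘ Fin.suc))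
    ... | false = length-filter-tabulate p (g ∘ Fin.suc)

    count-∧-false : (p : Fin n → Bool) → count (λ u → p u ∧ false) ≡ 0
    count-∧-false {zero}  p = refl
    count-∧-false {suc n} p rewrite ∧-zeroʳ (p Fin.zero) = count-∧-false (p ∘ Fin.suc)

    below≡count : ∀ (τ : Subset n) v → below τ v ≡ count (λ u → lookup τ u ∧ (toℕ u <ᵇ toℕ v))
    below≡count τ v = length-filter-tabulate (λ u → lookup τ u ∧ (toℕ u <ᵇ toℕ v)) id

  below-∷-zero : ∀ a (τ : Subset n) → below (a ∷ τ) Fin.zero ≡ 0
  below-∷-zero a τ = trans (below≡count (a ∷ τ) Fin.zero) (count-∧-false (lookup (a ∷ τ)))

  below-∷-suc : ∀ a (τ : Subset n) v → below (a ∷ τ) (Fin.suc v) ≡ (if a then suc else id) (below τ v)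
  below-∷-suc a τ v = trans (below≡count (a ∷ τ) (Fin.suc v)) (from-count a)
    where
    from-count : ∀ a → count (λ u → lookup (a ∷ τ) u ∧ (toℕ u <ᵇ suc (toℕ v))) ≡ (if a then suc else id) (below τ v)
    from-count true  = cong suc (sym (below≡count τ v))
    from-count false = sym (below≡count τ v)

  below-++ˡ : ∀ (τ₁ : Subset n) (τ₂ : Subset m) i → below (τ₁ ++ τ₂) (i ↑ˡ m) ≡ below τ₁ i
  below-++ˡ (a ∷ τ₁) τ₂ Fin.zero    = trans (below-∷-zero a (τ₁ ++ τ₂)) (sym (below-∷-zero a τ₁))
  below-++ˡ (a ∷ τ₁) τ₂ (Fin.suc i) = begin
    below (a ∷ τ₁ ++ τ₂) (Fin.suc (i ↑ˡ _))          ≡⟨ below-∷-suc a (τ₁ ++ τ₂) (i ↑ˡ _) ⟩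
    (if a then suc else id) (below (τ₁ ++ τ₂) (i ↑ˡ _)) ≡⟨ cong (if a then suc else id) (below-++ˡ τ₁ τ₂ i) ⟩
    (if a then suc else id) (below τ₁ i)               ≡⟨ below-∷-suc a τ₁ i ⟨
    below (a ∷ τ₁) (Fin.suc i)                         ∎

  below-++ʳ : ∀ (τ₁ : Subset n) (τ₂ : Subset m) j → below (τ₁ ++ τ₂) (n ↑ʳ j) ≡ ∣ τ₁ ∣ ℕ.+ below τ₂ j
  below-++ʳ []           τ₂ j = refl
  below-++ʳ (true  ∷ τ₁) τ₂ j = trans (below-∷-suc true (τ₁ ++ τ₂) _) (cong suc (below-++ʳ τ₁ τ₂ j))
  below-++ʳ (false ∷ τ₁) τ₂ j = trans (below-∷-suc false (τ₁ ++ τ₂) _) (below-++ʳ τ₁ τ₂ j)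

  private
    suc-if-comm : ∀ a b x → (if a then suc else id) ((if b then suc else id) x)
                          ≡ (if b then suc else id) ((if a then suc else id) x)
    suc-if-comm true  true  x = refl
    suc-if-comm true  false x = refl
    suc-if-comm false b     x = refl

  below-∪⁅⁆ : ∀ (τ : Subset n) w v → lookup τ w ≡ false →
              below (τ ∪ ⁅ w ⁆) v ≡ (if toℕ w <ᵇ toℕ v then suc else id) (below τ v)
  below-∪⁅⁆ (false ∷ τ) Fin.zero    Fin.zero    _ = trans (below-∷-zero true (τ ∪ ⊥)) (sym (below-∷-zero false τ))
  below-∪⁅⁆ (false ∷ τ) Fin.zero    (Fin.suc v) _ = begin
    below (true ∷ τ ∪ ⊥) (Fin.suc v)  ≡⟨ below-∷-suc true (τ ∪ ⊥) v ⟩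
    suc (below (τ ∪ ⊥) v)             ≡⟨ cong (λ σ → suc (below σ v)) (∪-identityʳ τ) ⟩
    suc (below τ v)                   ≡⟨ cong suc (below-∷-suc false τ v) ⟨
    suc (below (false ∷ τ) (Fin.suc v)) ∎
  below-∪⁅⁆ (a ∷ τ)     (Fin.suc w) Fin.zero    _ = trans (below-∷-zero (a ∨ false) (τ ∪ ⁅ w ⁆)) (sym (below-∷-zero a τ))
  below-∪⁅⁆ (a ∷ τ)     (Fin.suc w) (Fin.suc v) w∉τ = begin
    below ((a ∨ false) ∷ τ ∪ ⁅ w ⁆) (Fin.suc v)
      ≡⟨ below-∷-suc (a ∨ false) (τ ∪ ⁅ w ⁆) v ⟩
    (if a ∨ false then suc else id) (below (τ ∪ ⁅ w ⁆) v)
      ≡⟨ cong₂ (λ b x → (if b then suc else id) x) (∨-identityʳ a) (below-∪⁅⁆ τ w v w∉τ) ⟩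
    (if a then suc else id) ((if toℕ w <ᵇ toℕ v then suc else id) (below τ v))
      ≡⟨ suc-if-comm a (toℕ w <ᵇ toℕ v) (below τ v) ⟩
    (if toℕ w <ᵇ toℕ v then suc else id) ((if a then suc else id) (below τ v))
      ≡⟨ cong (if toℕ w <ᵇ toℕ v then suc else id) (below-∷-suc a τ v) ⟨
    (if toℕ w <ᵇ toℕ v then suc else id) (below (a ∷ τ) (Fin.suc v)) ∎

  below-∪⁅⁆-< : ∀ (τ : Subset n) v w → lookup τ v ≡ false → (toℕ v <ᵇ toℕ w) ≡ true →
                below (τ ∪ ⁅ v ⁆) w ≡ suc (below τ w)
  below-∪⁅⁆-< τ v w v∉τ v<w = trans (below-∪⁅⁆ τ v w v∉τ) (cong (λ b → (if b then suc else id) (below τ w)) v<w)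

  below-∪⁅⁆-≮ : ∀ (τ : Subset n) v w → lookup τ v ≡ false → (toℕ v <ᵇ toℕ w) ≡ false →
                below (τ ∪ ⁅ v ⁆) w ≡ below τ w
  below-∪⁅⁆-≮ τ v w v∉τ v≮w = trans (below-∪⁅⁆ τ v w v∉τ) (cong (λ b → (if b then suc else id) (below τ w)) v≮w)

  ∣∪⁅⁆∣ : ∀ (τ : Subset n) w → lookup τ w ≡ false → ∣ τ ∪ ⁅ w ⁆ ∣ ≡ suc ∣ τ ∣
  ∣∪⁅⁆∣ (false ∷ τ) Fin.zero    _   = cong (suc ∘ ∣_∣) (∪-identityʳ τ)
  ∣∪⁅⁆∣ (true  ∷ τ) (Fin.suc w) w∉τ = cong suc (∣∪⁅⁆∣ τ w w∉τ)
  ∣∪⁅⁆∣ (false ∷ τ) (Fin.suc w) w∉τ = ∣∪⁅⁆∣ τ w w∉τ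

  lookup-∪⁅⁆ : ∀ (τ : Subset n) v w → lookup (τ ∪ ⁅ v ⁆) w ≡ lookup τ w ∨ lookup ⁅ v ⁆ w
  lookup-∪⁅⁆ τ v w = lookup-zipWith _∨_ w τ ⁅ v ⁆

  lookup-∪⁅⁆-self : ∀ (τ : Subset n) v → lookup (τ ∪ ⁅ v ⁆) v ≡ true
  lookup-∪⁅⁆-self τ v = trans (lookup-∪⁅⁆ τ v v)
    (trans (cong (lookup τ v ∨_) ([]=⇒lookup (x∈⁅x⁆ v))) (∨-zeroʳ (lookup τ v)))

  lookup-∪⁅⁆-∈ : ∀ (τ : Subset n) v {w} → lookup τ w ≡ true → lookup (τ ∪ ⁅ v ⁆) w ≡ true
  lookup-∪⁅⁆-∈ τ v {w} w∈τ = trans (lookup-∪⁅⁆ τ v w) (cong (_∨ lookup ⁅ v ⁆ w) w∈τ)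

  lookup-∪⁅⁆-≢ : ∀ (τ : Subset n) {v w} → w ≢ v → lookup (τ ∪ ⁅ v ⁆) w ≡ lookup τ w
  lookup-∪⁅⁆-≢ τ {v} {w} w≢v = trans (lookup-∪⁅⁆ τ v w)
    (trans (cong (lookup τ w ∨_) w∉⁅v⁆) (∨-identityʳ (lookup τ w)))
    where
    w∉⁅v⁆ : lookup ⁅ v ⁆ w ≡ false
    w∉⁅v⁆ = ¬-not λ w∈⁅v⁆ → x≢y⇒x∉⁅y⁆ w≢v (lookup⇒[]= w ⁅ v ⁆ w∈⁅v⁆)

  ∪⁅⁆-─⁅⁆ : ∀ (τ : Subset n) v → lookup τ v ≡ false → (τ ∪ ⁅ v ⁆) ─ ⁅ v ⁆ ≡ τ
  ∪⁅⁆-─⁅⁆ (false ∷ τ) Fin.zero    _   = cong (false ∷_) (trans (p─⊥≡p (τ ∪ ⊥)) (∪-identityʳ τ))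
  ∪⁅⁆-─⁅⁆ (a ∷ τ)     (Fin.suc v) v∉τ = cong₂ _∷_ (∨-identityʳ a) (∪⁅⁆-─⁅⁆ τ v v∉τ)

  ∪⁅⁆-++ˡ : ∀ (τ₁ : Subset n) (τ₂ : Subset m) i → (τ₁ ++ τ₂) ∪ ⁅ i ↑ˡ m ⁆ ≡ (τ₁ ∪ ⁅ i ⁆) ++ τ₂
  ∪⁅⁆-++ˡ (a ∷ τ₁) τ₂ Fin.zero    =
    cong ((a ∨ true) ∷_) (trans (∪-identityʳ (τ₁ ++ τ₂)) (cong (_++ τ₂) (sym (∪-identityʳ τ₁))))
  ∪⁅⁆-++ˡ (a ∷ τ₁) τ₂ (Fin.suc i) = cong ((a ∨ false) ∷_) (∪⁅⁆-++ˡ τ₁ τ₂ i)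

  ∪⁅⁆-++ʳ : ∀ (τ₁ : Subset n) (τ₂ : Subset m) j → (τ₁ ++ τ₂) ∪ ⁅ n ↑ʳ j ⁆ ≡ τ₁ ++ (τ₂ ∪ ⁅ j ⁆)
  ∪⁅⁆-++ʳ []       τ₂ j = refl
  ∪⁅⁆-++ʳ (a ∷ τ₁) τ₂ j = cong₂ _∷_ (∨-identityʳ a) (∪⁅⁆-++ʳ τ₁ τ₂ j)

  incidence : Subset n → Fin n → ℚ → ℚ
  incidence τ v x = if lookup τ v then 0ℚ else signed (below τ v) x

  private
    if0-additive : ∀ b k → Additive (λ x → if b then 0ℚ else signed k x)
    if0-additive true  k = record { map-0 = refl ; map-+ = λ _ _ → sym (ℚP.+-identityˡ 0ℚ) ; map-neg = λ _ → refl }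
    if0-additive false k = signed-additive k

    map-if0 : ∀ {h} → Additive h → ∀ b x → h (if b then 0ℚ else x) ≡ (if b then 0ℚ else h x)
    map-if0 h true  x = map-0 h
    map-if0 h false x = refl

  incidence-additive : ∀ (τ : Subset n) v → Additive (incidence τ v)
  incidence-additive τ v = if0-additive (lookup τ v) (below τ v)

  map-incidence : ∀ {h} → Additive h → ∀ (τ : Subset n) v x → h (incidence τ v x) ≡ incidence τ v (h x)
  map-incidence h τ v x =
    trans (map-if0 h (lookup τ v) (signed (below τ v) x)) (cong (if lookup τ v then 0ℚ else_) (map-signed h (below τ v) x))

  incidence-∈ : ∀ (τ : Subset n) v → lookup τ v ≡ true → ∀ x → incidence τ v x ≡ 0ℚ
  incidence-∈ τ v v∈τ x = cong (λ b → if b then 0ℚ else signed (below τ v) x) v∈τ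

  incidence-∉ : ∀ (τ : Subset n) v → lookup τ v ≡ false → ∀ x → incidence τ v x ≡ signed (below τ v) x
  incidence-∉ τ v v∉τ x = cong (λ b → if b then 0ℚ else signed (below τ v) x) v∉τ

  incidence-++ˡ : ∀ (τ₁ : Subset n) (τ₂ : Subset m) i x → incidence (τ₁ ++ τ₂) (i ↑ˡ m) x ≡ incidence τ₁ i x
  incidence-++ˡ τ₁ τ₂ i x = cong₂ (λ b k → if b then 0ℚ else signed k x) (lookup-++ˡ τ₁ τ₂ i) (below-++ˡ τ₁ τ₂ i)

  incidence-++ʳ : ∀ (τ₁ : Subset n) (τ₂ : Subset m) j x →
                  incidence (τ₁ ++ τ₂) (n ↑ʳ j) x ≡ signed ∣ τ₁ ∣ (incidence τ₂ j x)
  incidence-++ʳ τ₁ τ₂ j x = begin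
    incidence (τ₁ ++ τ₂) (_ ↑ʳ j) x
      ≡⟨ cong₂ (λ b k → if b then 0ℚ else signed k x) (lookup-++ʳ τ₁ τ₂ j) (below-++ʳ τ₁ τ₂ j) ⟩
    (if lookup τ₂ j then 0ℚ else signed (∣ τ₁ ∣ ℕ.+ below τ₂ j) x)
      ≡⟨ cong (if lookup τ₂ j then 0ℚ else_) (signed-+ ∣ τ₁ ∣ (below τ₂ j) x) ⟩
    (if lookup τ₂ j then 0ℚ else signed ∣ τ₁ ∣ (signed (below τ₂ j) x))
      ≡⟨ map-if0 (signed-additive ∣ τ₁ ∣) (lookup τ₂ j) (signed (below τ₂ j) x) ⟨
    signed ∣ τ₁ ∣ (incidence τ₂ j x)
      ∎

  ∂≡sum : ∀ (c : Chain n) τ → ∂ c τ ≡ sum (λ v → incidence τ v (c (τ ∪ ⁅ v ⁆)))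
  ∂≡sum c τ = sumFin≡sum (λ v → incidence τ v (c (τ ∪ ⁅ v ⁆)))

  ∂-local : ∀ {c d : Chain n} τ → (∀ v → lookup τ v ≡ false → c (τ ∪ ⁅ v ⁆) ≡ d (τ ∪ ⁅ v ⁆)) →
            ∂ c τ ≡ ∂ d τ
  ∂-local {c = c} {d} τ c≗d = begin
    ∂ c τ                                        ≡⟨ ∂≡sum c τ ⟩
    sum (λ v → incidence τ v (c (τ ∪ ⁅ v ⁆)))   ≡⟨ sum-cong-≗ termwise ⟩
    sum (λ v → incidence τ v (d (τ ∪ ⁅ v ⁆)))   ≡⟨ ∂≡sum d τ ⟨
    ∂ d τ                                        ∎
    where
    termwise : ∀ v → incidence τ v (c (τ ∪ ⁅ v ⁆)) ≡ incidence τ v (d (τ ∪ ⁅ v ⁆))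
    termwise v with lookup τ v in v∈τ?
    ... | true  = refl
    ... | false = cong (signed (below τ v)) (c≗d v v∈τ?)

  ∂-cong : ∀ {c d : Chain n} → c ≗ d → ∀ τ → ∂ c τ ≡ ∂ d τ
  ∂-cong {c = c} {d} c≗d τ = ∂-local {c = c} {d} τ (λ v _ → c≗d (τ ∪ ⁅ v ⁆))

  ∂-map : ∀ {h} → Additive h → ∀ (c : Chain n) τ → ∂ (h ∘ c) τ ≡ h (∂ c τ)
  ∂-map {h = h} h-additive c τ = begin
    ∂ (h ∘ c) τ
      ≡⟨ ∂≡sum (h ∘ c) τ ⟩
    sum (λ v → incidence τ v (h (c (τ ∪ ⁅ v ⁆))))
      ≡⟨ sum-cong-≗ (λ v → map-incidence h-additive τ v (c (τ ∪ ⁅ v ⁆))) ⟨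
    sum (λ v → h (incidence τ v (c (τ ∪ ⁅ v ⁆))))
      ≡⟨ map-sum h-additive (λ v → incidence τ v (c (τ ∪ ⁅ v ⁆))) ⟨
    h (sum (λ v → incidence τ v (c (τ ∪ ⁅ v ⁆))))
      ≡⟨ cong h (∂≡sum c τ) ⟨
    h (∂ c τ)
      ∎

  ∂-+ : ∀ (c d : Chain n) τ → ∂ (λ σ → c σ + d σ) τ ≡ ∂ c τ + ∂ d τ
  ∂-+ c d τ = begin
    ∂ (λ σ → c σ + d σ) τ
      ≡⟨ ∂≡sum (λ σ → c σ + d σ) τ ⟩
    sum (λ v → incidence τ v (c (τ ∪ ⁅ v ⁆) + d (τ ∪ ⁅ v ⁆)))
      ≡⟨ sum-cong-≗ (λ v → map-+ (incidence-additive τ v) (c (τ ∪ ⁅ v ⁆)) (d (τ ∪ ⁅ v ⁆))) ⟩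
    sum (λ v → incidence τ v (c (τ ∪ ⁅ v ⁆)) + incidence τ v (d (τ ∪ ⁅ v ⁆)))
      ≡⟨ ∑-distrib-+ (λ v → incidence τ v (c (τ ∪ ⁅ v ⁆))) (λ v → incidence τ v (d (τ ∪ ⁅ v ⁆))) ⟩
    sum (λ v → incidence τ v (c (τ ∪ ⁅ v ⁆))) + sum (λ v → incidence τ v (d (τ ∪ ⁅ v ⁆)))
      ≡⟨ cong₂ _+_ (∂≡sum c τ) (∂≡sum d τ) ⟨
    ∂ c τ + ∂ d τ
      ∎

  ∂-support : ∀ (c : Chain n) τ → ∂ c τ ≢ 0ℚ → Σ[ v ∈ Fin n ] lookup τ v ≡ false × c (τ ∪ ⁅ v ⁆) ≢ 0ℚ
  ∂-support c τ ∂c≢0 with sum-nonzero _ (λ sum≡0 → ∂c≢0 (trans (∂≡sum c τ) sum≡0))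
  ... | v , term≢0 with lookup τ v in v∈τ?
  ...   | true  = ⊥-elim (term≢0 refl)
  ...   | false = v , v∈τ? , λ c≡0 → term≢0 (trans (cong (signed (below τ v)) c≡0) (map-0 (signed-additive (below τ v))))

  ∂-comm : ∀ {a b} (Z : Subset a → Subset b → ℚ) τa τb →
           ∂ (λ σ → ∂ (Z σ) τb) τa ≡ ∂ (λ ρ → ∂ (λ σ → Z σ ρ) τa) τb
  ∂-comm Z τa τb = begin
    ∂ (λ σ → ∂ (Z σ) τb) τa
      ≡⟨ ∂∘∂≡double-sum Z τa τb ⟩
    sum (λ u → sum (λ w → incidence τa u (incidence τb w (Z (τa ∪ ⁅ u ⁆) (τb ∪ ⁅ w ⁆)))))
      ≡⟨ ∑-comm (λ u w → incidence τa u (incidence τb w (Z (τa ∪ ⁅ u ⁆) (τb ∪ ⁅ w ⁆)))) ⟩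
    sum (λ w → sum (λ u → incidence τa u (incidence τb w (Z (τa ∪ ⁅ u ⁆) (τb ∪ ⁅ w ⁆)))))
      ≡⟨ sum-cong-≗ (λ w → sum-cong-≗ (λ u →
           map-incidence (incidence-additive τa u) τb w (Z (τa ∪ ⁅ u ⁆) (τb ∪ ⁅ w ⁆)))) ⟩
    sum (λ w → sum (λ u → incidence τb w (incidence τa u (Z (τa ∪ ⁅ u ⁆) (τb ∪ ⁅ w ⁆)))))
      ≡⟨ ∂∘∂≡double-sum (λ ρ σ → Z σ ρ) τb τa ⟨
    ∂ (λ ρ → ∂ (λ σ → Z σ ρ) τa) τb
      ∎
    where
    ∂∘∂≡double-sum : ∀ {a b} (Z : Subset a → Subset b → ℚ) τa τb → ∂ (λ σ → ∂ (Z σ) τb) τa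
      ≡ sum (λ u → sum (λ w → incidence τa u (incidence τb w (Z (τa ∪ ⁅ u ⁆) (τb ∪ ⁅ w ⁆)))))
    ∂∘∂≡double-sum Z τa τb = begin
      ∂ (λ σ → ∂ (Z σ) τb) τa
        ≡⟨ ∂≡sum (λ σ → ∂ (Z σ) τb) τa ⟩
      sum (λ u → incidence τa u (∂ (Z (τa ∪ ⁅ u ⁆)) τb))
        ≡⟨ sum-cong-≗ (λ u → cong (incidence τa u) (∂≡sum (Z (τa ∪ ⁅ u ⁆)) τb)) ⟩
      sum (λ u → incidence τa u (sum (λ w → incidence τb w (Z (τa ∪ ⁅ u ⁆) (τb ∪ ⁅ w ⁆)))))
        ≡⟨ sum-cong-≗ (λ u →
             map-sum (incidence-additive τa u) (λ w → incidence τb w (Z (τa ∪ ⁅ u ⁆) (τb ∪ ⁅ w ⁆)))) ⟩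
      sum (λ u → sum (λ w → incidence τa u (incidence τb w (Z (τa ∪ ⁅ u ⁆) (τb ∪ ⁅ w ⁆)))))
        ∎

  private
    true-or-false : ∀ b → b ≡ true ⊎ b ≡ false
    true-or-false true  = inj₁ refl
    true-or-false false = inj₂ refl

    ∂²-term : Chain n → Subset n → Fin n → Fin n → ℚ
    ∂²-term c τ v w = incidence τ v (incidence (τ ∪ ⁅ v ⁆) w (c ((τ ∪ ⁅ v ⁆) ∪ ⁅ w ⁆)))

    ∂∂≡double-sum : ∀ (c : Chain n) τ → ∂ (∂ c) τ ≡ sum (λ v → sum (∂²-term c τ v))
    ∂∂≡double-sum c τ = begin
      ∂ (∂ c) τ
        ≡⟨ ∂≡sum (∂ c) τ ⟩
      sum (λ v → incidence τ v (∂ c (τ ∪ ⁅ v ⁆)))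
        ≡⟨ sum-cong-≗ (λ v → cong (incidence τ v) (∂≡sum c (τ ∪ ⁅ v ⁆))) ⟩
      sum (λ v → incidence τ v (sum (λ w → incidence (τ ∪ ⁅ v ⁆) w (c ((τ ∪ ⁅ v ⁆) ∪ ⁅ w ⁆)))))
        ≡⟨ sum-cong-≗ (λ v →
             map-sum (incidence-additive τ v) (λ w → incidence (τ ∪ ⁅ v ⁆) w (c ((τ ∪ ⁅ v ⁆) ∪ ⁅ w ⁆)))) ⟩
      sum (λ v → sum (∂²-term c τ v))
        ∎

    ∂²-term-zero : ∀ (c : Chain n) τ v w → lookup τ v ≡ true ⊎ lookup (τ ∪ ⁅ v ⁆) w ≡ true →
                   ∂²-term c τ v w ≡ 0ℚ
    ∂²-term-zero c τ v w (inj₁ v∈τ)   = incidence-∈ τ v v∈τ (incidence (τ ∪ ⁅ v ⁆) w (c ((τ ∪ ⁅ v ⁆) ∪ ⁅ w ⁆)))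
    ∂²-term-zero c τ v w (inj₂ w∈τ∪v) = trans (cong (incidence τ v) (incidence-∈ (τ ∪ ⁅ v ⁆) w w∈τ∪v (c ((τ ∪ ⁅ v ⁆) ∪ ⁅ w ⁆))))
                                              (map-0 (incidence-additive τ v))

    ∂²-term-∉ : ∀ (c : Chain n) τ v w → lookup τ v ≡ false → lookup τ w ≡ false → w ≢ v →
                ∂²-term c τ v w ≡ signed (below τ v) (signed (below (τ ∪ ⁅ v ⁆) w) (c ((τ ∪ ⁅ v ⁆) ∪ ⁅ w ⁆)))
    ∂²-term-∉ c τ v w v∉τ w∉τ w≢v =
      trans (incidence-∉ τ v v∉τ (incidence (τ ∪ ⁅ v ⁆) w X)) (cong (signed (below τ v)) (incidence-∉ (τ ∪ ⁅ v ⁆) w w∉τ∪v X))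
      where
      X : ℚ
      X = c ((τ ∪ ⁅ v ⁆) ∪ ⁅ w ⁆)
      w∉τ∪v : lookup (τ ∪ ⁅ v ⁆) w ≡ false
      w∉τ∪v = trans (lookup-∪⁅⁆-≢ τ w≢v) w∉τ

    -- the two ways of adding v and w to τ carry opposite signs
    ∂²-term-antisym-< : ∀ (c : Chain n) τ v w → lookup τ v ≡ false → lookup τ w ≡ false → w ≢ v →
      (toℕ v <ᵇ toℕ w) ≡ true → (toℕ w <ᵇ toℕ v) ≡ false → ∂²-term c τ v w ≡ - ∂²-term c τ w v
    ∂²-term-antisym-< c τ v w v∉τ w∉τ w≢v v<w w≮v = begin
      ∂²-term c τ v w
        ≡⟨ ∂²-term-∉ c τ v w v∉τ w∉τ w≢v ⟩
      signed (below τ v) (signed (below (τ ∪ ⁅ v ⁆) w) (c ((τ ∪ ⁅ v ⁆) ∪ ⁅ w ⁆)))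
        ≡⟨ cong₂ (λ k σ → signed (below τ v) (signed k (c σ))) (below-∪⁅⁆-< τ v w v∉τ v<w) ∪⁅⁆-swap ⟩
      signed (below τ v) (- signed (below τ w) (c ((τ ∪ ⁅ w ⁆) ∪ ⁅ v ⁆)))
        ≡⟨ map-neg (signed-additive (below τ v)) (signed (below τ w) (c ((τ ∪ ⁅ w ⁆) ∪ ⁅ v ⁆))) ⟩
      - signed (below τ v) (signed (below τ w) (c ((τ ∪ ⁅ w ⁆) ∪ ⁅ v ⁆)))
        ≡⟨ cong -_ (signed-comm (below τ v) (below τ w) (c ((τ ∪ ⁅ w ⁆) ∪ ⁅ v ⁆))) ⟩
      - signed (below τ w) (signed (below τ v) (c ((τ ∪ ⁅ w ⁆) ∪ ⁅ v ⁆)))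
        ≡⟨ cong (λ k → - signed (below τ w) (signed k (c ((τ ∪ ⁅ w ⁆) ∪ ⁅ v ⁆)))) (below-∪⁅⁆-≮ τ w v w∉τ w≮v) ⟨
      - signed (below τ w) (signed (below (τ ∪ ⁅ w ⁆) v) (c ((τ ∪ ⁅ w ⁆) ∪ ⁅ v ⁆)))
        ≡⟨ cong -_ (∂²-term-∉ c τ w v w∉τ v∉τ (w≢v ∘ sym)) ⟨
      - ∂²-term c τ w v
        ∎
      where
      ∪⁅⁆-swap : (τ ∪ ⁅ v ⁆) ∪ ⁅ w ⁆ ≡ (τ ∪ ⁅ w ⁆) ∪ ⁅ v ⁆
      ∪⁅⁆-swap = trans (∪-assoc τ ⁅ v ⁆ ⁅ w ⁆)
                       (trans (cong (τ ∪_) (∪-comm ⁅ v ⁆ ⁅ w ⁆)) (sym (∪-assoc τ ⁅ w ⁆ ⁅ v ⁆)))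

    ∂²-terms-zero : ∀ (c : Chain n) τ v w →
      lookup τ v ≡ true ⊎ lookup (τ ∪ ⁅ v ⁆) w ≡ true → lookup τ w ≡ true ⊎ lookup (τ ∪ ⁅ w ⁆) v ≡ true →
      ∂²-term c τ v w ≡ - ∂²-term c τ w v
    ∂²-terms-zero c τ v w vw wv = trans (∂²-term-zero c τ v w vw) (cong -_ (sym (∂²-term-zero c τ w v wv)))

    ∂²-term-antisym : ∀ (c : Chain n) τ v w → ∂²-term c τ v w ≡ - ∂²-term c τ w v
    ∂²-term-antisym c τ v w with true-or-false (lookup τ v) | true-or-false (lookup τ w)
    ... | inj₁ v∈τ | _        = ∂²-terms-zero c τ v w (inj₁ v∈τ) (inj₂ (lookup-∪⁅⁆-∈ τ w v∈τ))
    ... | inj₂ v∉τ | inj₁ w∈τ = ∂²-terms-zero c τ v w (inj₂ (lookup-∪⁅⁆-∈ τ v w∈τ)) (inj₁ w∈τ)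
    ... | inj₂ v∉τ | inj₂ w∉τ with v Fin.≟ w
    ...   | yes refl = ∂²-terms-zero c τ v v (inj₂ (lookup-∪⁅⁆-self τ v)) (inj₂ (lookup-∪⁅⁆-self τ v))
    ...   | no v≢w with true-or-false (toℕ v <ᵇ toℕ w) | true-or-false (toℕ w <ᵇ toℕ v)
    ...     | inj₁ v<w | inj₂ w≮v = ∂²-term-antisym-< c τ v w v∉τ w∉τ (v≢w ∘ sym) v<w w≮v
    ...     | inj₂ v≮w | inj₁ w<v = trans (sym (⁻¹-involutive (∂²-term c τ v w)))
                                          (cong -_ (sym (∂²-term-antisym-< c τ w v w∉τ v∉τ v≢w w<v v≮w)))
    ...     | inj₁ v<w | inj₁ w<v = ⊥-elim (<-asym (<ᵇ⇒< (toℕ v) (toℕ w) (subst T (sym v<w) _))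
                                                   (<ᵇ⇒< (toℕ w) (toℕ v) (subst T (sym w<v) _)))
    ...     | inj₂ v≮w | inj₂ w≮v = ⊥-elim (v≢w (toℕ-injective (≤-antisym (≮⇒≥ (λ w<v → subst T w≮v (<⇒<ᵇ w<v)))
                                                                         (≮⇒≥ (λ v<w → subst T v≮w (<⇒<ᵇ v<w))))))

  ∂∂ : ∀ (c : Chain n) τ → ∂ (∂ c) τ ≡ 0ℚ
  ∂∂ c τ = x≡-x⇒x≡0 (∂ (∂ c) τ) (begin
    ∂ (∂ c) τ                                   ≡⟨ ∂∂≡double-sum c τ ⟩
    sum (λ v → sum (∂²-term c τ v))             ≡⟨ ∑-comm (∂²-term c τ) ⟩
    sum (λ w → sum (λ v → ∂²-term c τ v w))     ≡⟨ sum-cong-≗ (λ w → sum-cong-≗ (λ v → ∂²-term-antisym c τ v w)) ⟩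
    sum (λ w → sum (λ v → - ∂²-term c τ w v))   ≡⟨ sum-cong-≗ (λ w → map-sum neg-additive (∂²-term c τ w)) ⟨
    sum (λ w → - sum (∂²-term c τ w))           ≡⟨ map-sum neg-additive (λ w → sum (∂²-term c τ w)) ⟨
    - sum (λ w → sum (∂²-term c τ w))           ≡⟨ cong -_ (∂∂≡double-sum c τ) ⟨
    - ∂ (∂ c) τ                                 ∎)

  -- Chains on a disjoint union of vertex sets

  ∂-++ : ∀ (z : Chain (n ℕ.+ m)) (τ₁ : Subset n) (τ₂ : Subset m) →
         ∂ z (τ₁ ++ τ₂) ≡ ∂ (λ σ → z (σ ++ τ₂)) τ₁ + signed ∣ τ₁ ∣ (∂ (λ ρ → z (τ₁ ++ ρ)) τ₂)
  ∂-++ {n} {m} z τ₁ τ₂ = begin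
    ∂ z (τ₁ ++ τ₂)
      ≡⟨ ∂≡sum z (τ₁ ++ τ₂) ⟩
    sum (λ x → incidence (τ₁ ++ τ₂) x (z ((τ₁ ++ τ₂) ∪ ⁅ x ⁆)))
      ≡⟨ sum-++ {n} {m} (λ x → incidence (τ₁ ++ τ₂) x (z ((τ₁ ++ τ₂) ∪ ⁅ x ⁆))) ⟩
    sum (λ i → incidence (τ₁ ++ τ₂) (i ↑ˡ m) (z ((τ₁ ++ τ₂) ∪ ⁅ i ↑ˡ m ⁆)))
      + sum (λ j → incidence (τ₁ ++ τ₂) (n ↑ʳ j) (z ((τ₁ ++ τ₂) ∪ ⁅ n ↑ʳ j ⁆)))
      ≡⟨ cong₂ _+_ (sum-cong-≗ first) (sum-cong-≗ second) ⟩
    sum (λ i → incidence τ₁ i (z ((τ₁ ∪ ⁅ i ⁆) ++ τ₂)))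
      + sum (λ j → signed (∣ τ₁ ∣) (incidence τ₂ j (z (τ₁ ++ (τ₂ ∪ ⁅ j ⁆)))))
      ≡⟨ cong (sum (λ i → incidence τ₁ i (z ((τ₁ ∪ ⁅ i ⁆) ++ τ₂))) +_)
              (map-sum (signed-additive (∣ τ₁ ∣)) (λ j → incidence τ₂ j (z (τ₁ ++ (τ₂ ∪ ⁅ j ⁆))))) ⟨
    sum (λ i → incidence τ₁ i (z ((τ₁ ∪ ⁅ i ⁆) ++ τ₂)))
      + signed (∣ τ₁ ∣) (sum (λ j → incidence τ₂ j (z (τ₁ ++ (τ₂ ∪ ⁅ j ⁆)))))
      ≡⟨ cong₂ (λ p q → p + signed (∣ τ₁ ∣) q) (∂≡sum (λ σ → z (σ ++ τ₂)) τ₁)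
                                                (∂≡sum (λ ρ → z (τ₁ ++ ρ)) τ₂) ⟨
    ∂ (λ σ → z (σ ++ τ₂)) τ₁ + signed (∣ τ₁ ∣) (∂ (λ ρ → z (τ₁ ++ ρ)) τ₂)
      ∎
    where
    first : ∀ i → incidence (τ₁ ++ τ₂) (i ↑ˡ m) (z ((τ₁ ++ τ₂) ∪ ⁅ i ↑ˡ m ⁆))
                ≡ incidence τ₁ i (z ((τ₁ ∪ ⁅ i ⁆) ++ τ₂))
    first i = trans (incidence-++ˡ τ₁ τ₂ i _) (cong (incidence τ₁ i ∘ z) (∪⁅⁆-++ˡ τ₁ τ₂ i))
    second : ∀ j → incidence (τ₁ ++ τ₂) (n ↑ʳ j) (z ((τ₁ ++ τ₂) ∪ ⁅ n ↑ʳ j ⁆))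
                 ≡ signed ∣ τ₁ ∣ (incidence τ₂ j (z (τ₁ ++ (τ₂ ∪ ⁅ j ⁆))))
    second j = trans (incidence-++ʳ τ₁ τ₂ j _) (cong (signed ∣ τ₁ ∣ ∘ incidence τ₂ j ∘ z) (∪⁅⁆-++ʳ τ₁ τ₂ j))

  slice : Subset n → Chain (n ℕ.+ m) → Chain m
  slice σ z ρ = ∂ (λ τ → z (τ ++ ρ)) σ

  slice-∂ : ∀ (σ : Subset n) (z : Chain (n ℕ.+ m)) ρ → slice σ (∂ z) ρ ≡ signed (suc ∣ σ ∣) (∂ (slice σ z) ρ)
  slice-∂ σ z ρ = begin
    ∂ (λ τ → ∂ z (τ ++ ρ)) σ
      ≡⟨ ∂-cong (λ τ → ∂-++ z τ ρ) σ ⟩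
    ∂ (λ τ → ∂ (λ τ′ → z (τ′ ++ ρ)) τ + signed ∣ τ ∣ (∂ (λ ρ′ → z (τ ++ ρ′)) ρ)) σ
      ≡⟨ ∂-+ (∂ (λ τ′ → z (τ′ ++ ρ))) (λ τ → signed ∣ τ ∣ (∂ (λ ρ′ → z (τ ++ ρ′)) ρ)) σ ⟩
    ∂ (∂ (λ τ′ → z (τ′ ++ ρ))) σ + ∂ (λ τ → signed ∣ τ ∣ (∂ (λ ρ′ → z (τ ++ ρ′)) ρ)) σ
      ≡⟨ cong₂ _+_ (∂∂ (λ τ′ → z (τ′ ++ ρ)) σ)
                   (∂-local {c = λ τ → signed ∣ τ ∣ (∂ (λ ρ′ → z (τ ++ ρ′)) ρ)}
                            {d = signed (suc ∣ σ ∣) ∘ (λ τ → ∂ (λ ρ′ → z (τ ++ ρ′)) ρ)} σ faces-of-σ) ⟩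
    0ℚ + ∂ (signed (suc ∣ σ ∣) ∘ (λ τ → ∂ (λ ρ′ → z (τ ++ ρ′)) ρ)) σ
      ≡⟨ ℚP.+-identityˡ _ ⟩
    ∂ (signed (suc ∣ σ ∣) ∘ (λ τ → ∂ (λ ρ′ → z (τ ++ ρ′)) ρ)) σ
      ≡⟨ ∂-map (signed-additive (suc ∣ σ ∣)) (λ τ → ∂ (λ ρ′ → z (τ ++ ρ′)) ρ) σ ⟩
    signed (suc ∣ σ ∣) (∂ (λ τ → ∂ (λ ρ′ → z (τ ++ ρ′)) ρ) σ)
      ≡⟨ cong (signed (suc ∣ σ ∣)) (∂-comm (λ τ ρ′ → z (τ ++ ρ′)) σ ρ) ⟩
    signed (suc ∣ σ ∣) (∂ (slice σ z) ρ)
      ∎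
    where
    faces-of-σ : ∀ v → lookup σ v ≡ false →
      signed ∣ σ ∪ ⁅ v ⁆ ∣ (∂ (λ ρ′ → z ((σ ∪ ⁅ v ⁆) ++ ρ′)) ρ)
        ≡ signed (suc ∣ σ ∣) (∂ (λ ρ′ → z ((σ ∪ ⁅ v ⁆) ++ ρ′)) ρ)
    faces-of-σ v v∉σ = cong (λ k → signed k (∂ (λ ρ′ → z ((σ ∪ ⁅ v ⁆) ++ ρ′)) ρ)) (∣∪⁅⁆∣ σ v v∉σ)

  ∂-slice-cong : ∀ (σ : Subset n) {b c : Chain (n ℕ.+ m)} → (∀ τ → ∂ b τ ≡ ∂ c τ) →
                 ∀ ρ → ∂ (slice σ b) ρ ≡ ∂ (slice σ c) ρ
  ∂-slice-cong σ {b} {c} ∂b≗∂c ρ = signed-injective (suc ∣ σ ∣) (begin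
    signed (suc ∣ σ ∣) (∂ (slice σ b) ρ)  ≡⟨ slice-∂ σ b ρ ⟨
    slice σ (∂ b) ρ                       ≡⟨ ∂-cong (λ τ → ∂b≗∂c (τ ++ ρ)) σ ⟩
    slice σ (∂ c) ρ                       ≡⟨ slice-∂ σ c ρ ⟩
    signed (suc ∣ σ ∣) (∂ (slice σ c) ρ)  ∎)

  slice-support : ∀ (σ : Subset n) (z : Chain (n ℕ.+ m)) ρ → slice σ z ρ ≢ 0ℚ →
                  Σ[ v ∈ Fin n ] lookup σ v ≡ false × z ((σ ∪ ⁅ v ⁆) ++ ρ) ≢ 0ℚ
  slice-support σ z ρ = ∂-support (λ τ → z (τ ++ ρ)) σ

  ∂-++-[] : ∀ (σ : Subset n) (z : Chain (n ℕ.+ 0)) → ∂ z (σ ++ []) ≡ slice σ z []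
  ∂-++-[] σ z = trans (∂-++ z σ [])
    (trans (cong (slice σ z [] +_) (map-0 (signed-additive ∣ σ ∣))) (ℚP.+-identityʳ (slice σ z [])))

  _⊗_ : Chain n → Chain m → Chain (n ℕ.+ m)
  _⊗_ {n} x y ρ = x (take n ρ) * y (drop n ρ)

  ⊗-++ : ∀ (x : Chain n) (y : Chain m) τ₁ τ₂ → (x ⊗ y) (τ₁ ++ τ₂) ≡ x τ₁ * y τ₂
  ⊗-++ {n} x y τ₁ τ₂ = cong₂ (λ σ ρ → x σ * y ρ) (++-injectiveˡ (take n (τ₁ ++ τ₂)) τ₁ split)
                                                 (++-injectiveʳ (take n (τ₁ ++ τ₂)) τ₁ split)
    where
    split : take n (τ₁ ++ τ₂) ++ drop n (τ₁ ++ τ₂) ≡ τ₁ ++ τ₂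
    split = take++drop≡id n (τ₁ ++ τ₂)

  ∂-⊗ : ∀ (x : Chain n) (y : Chain m) τ₁ τ₂ →
        ∂ (x ⊗ y) (τ₁ ++ τ₂) ≡ ∂ x τ₁ * y τ₂ + signed ∣ τ₁ ∣ (x τ₁ * ∂ y τ₂)
  ∂-⊗ x y τ₁ τ₂ = begin
    ∂ (x ⊗ y) (τ₁ ++ τ₂)
      ≡⟨ ∂-++ (x ⊗ y) τ₁ τ₂ ⟩
    ∂ (λ σ → (x ⊗ y) (σ ++ τ₂)) τ₁ + signed (∣ τ₁ ∣) (∂ (λ ρ → (x ⊗ y) (τ₁ ++ ρ)) τ₂)
      ≡⟨ cong₂ (λ p q → p + signed (∣ τ₁ ∣) q) (∂-cong (λ σ → ⊗-++ x y σ τ₂) τ₁)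
                                                (∂-cong (⊗-++ x y τ₁) τ₂) ⟩
    ∂ (λ σ → x σ * y τ₂) τ₁ + signed (∣ τ₁ ∣) (∂ (λ ρ → x τ₁ * y ρ) τ₂)
      ≡⟨ cong₂ (λ p q → p + signed (∣ τ₁ ∣) q) (∂-map (*ʳ-additive (y τ₂)) x τ₁)
                                                (∂-map (*ˡ-additive (x τ₁)) y τ₂) ⟩
    ∂ x τ₁ * y τ₂ + signed (∣ τ₁ ∣) (x τ₁ * ∂ y τ₂)
      ∎

  slice-⊗ : ∀ (σ : Subset n) (x : Chain n) (y : Chain m) ρ → slice σ (x ⊗ y) ρ ≡ ∂ x σ * y ρ
  slice-⊗ σ x y ρ = trans (∂-cong (λ τ → ⊗-++ x y τ ρ) σ) (∂-map (*ʳ-additive (y ρ)) x σ)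

  ⊗-support : ∀ (x : Chain n) (y : Chain m) τ₁ τ₂ → (x ⊗ y) (τ₁ ++ τ₂) ≢ 0ℚ → x τ₁ ≢ 0ℚ × y τ₂ ≢ 0ℚ
  ⊗-support x y τ₁ τ₂ xy≢0 = *-nonzero (xy≢0 ∘ trans (⊗-++ x y τ₁ τ₂))

  ∂-⊗-support : ∀ (x : Chain n) (y : Chain m) τ₁ τ₂ → ∂ (x ⊗ y) (τ₁ ++ τ₂) ≢ 0ℚ →
                (∂ x τ₁ ≢ 0ℚ × y τ₂ ≢ 0ℚ) ⊎ (x τ₁ ≢ 0ℚ × ∂ y τ₂ ≢ 0ℚ)
  ∂-⊗-support x y τ₁ τ₂ ∂xy≢0 with +-nonzero (∂xy≢0 ∘ trans (∂-⊗ x y τ₁ τ₂))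
  ... | inj₁ first  = inj₁ (*-nonzero first)
  ... | inj₂ second =
    inj₂ (*-nonzero λ xy≡0 → second (trans (cong (signed ∣ τ₁ ∣) xy≡0) (map-0 (signed-additive ∣ τ₁ ∣))))

open Chains

open import Data.Bool as Bool using (true; false; if_then_else_)
open import Data.Bool.ListAction using (any)
open import Data.Empty using (⊥-elim)
open import Data.Fin as Fin using (Fin; toℕ; _↑ˡ_; _↑ʳ_)
open import Data.Fin.Properties using (toℕ-↑ˡ; toℕ-↑ʳ; toℕ<n; all?)
open import Data.Fin.Subset using (Subset; _∈_; _⊆_; ∣_∣; ⊥; ⊤; ⁅_⁆; _∪_; _─_; ∁; inside; outside)
open import Data.Fin.Subset.Properties using (∉⊥; ⊆⊤; _∈?_; _⊆?_; x∈p∪q⁺; x∈⁅x⁆)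
open import Data.List using (List; []; _∷_; concatMap)
open import Data.List.Membership.DecPropositional using () renaming (_∈?_ to member?)
open import Data.List.Membership.Propositional using (find) renaming (_∈_ to _∈ₗ_)
open import Data.List.Membership.Propositional.Properties using (∈-concatMap⁺)
open import Data.List.Relation.Unary.All as All using (All)
open import Data.List.Relation.Unary.Any as Any using (Any; here; there)
open import Data.Nat as ℕ using (ℕ; zero; suc; _≤_; _<_; _+_; _*_; _∸_; z≤n; s≤s; s≤s⁻¹; _<?_; _≤?_; _≟_)
open import Data.Nat.DivMod using (_/_; _%_; m<n⇒m/n≡0; m<n⇒m%n≡m; [m+n]%n≡m%n; m/n≡1+[m∸n]/n)
open import Data.Nat.Properties
  using (+-mono-≤; +-mono-<-≤; +-mono-≤-<; +-monoʳ-<; +-cancelˡ-<; *-suc; m≤m+n; +-comm; suc-injective; 0≢1+n;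
         m+[n∸m]≡n; ∸-monoˡ-<; m≤n⇒m≤1+n; ≤-reflexive; ≮⇒≥)
open import Data.Product using (_×_; _,_; proj₁; proj₂; ∃-syntax)
open import Data.Rational as ℚ using (ℚ; 0ℚ; 1ℚ; -_)
import Data.Rational.Properties as ℚP
open import Data.Sum using (_⊎_; inj₁; inj₂; [_,_]′)
open import Data.Vec as Vec using (_∷_; _++_; take; drop; lookup)
import Data.Vec.Properties as Vec
open import Function using (_∘_; _∘′_)
open import Relation.Binary.PropositionalEquality
open import Relation.Nullary using (¬_; Dec; yes; no; does)
open import Relation.Nullary.Decidable using (dec-true; decidable-stable; map′; from-yes; _×-dec_; _⊎-dec_; _→-dec_; ¬?)

private
  variable
    n m : ℕ

data JoinView (n m : ℕ) : Fin (n + m) → Set where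
  left  : ∀ i → JoinView n m (i ↑ˡ m)
  right : ∀ j → JoinView n m (n ↑ʳ j)

joinView : ∀ n {m} x → JoinView n m x
joinView zero    x           = right x
joinView (suc n) Fin.zero    = left Fin.zero
joinView (suc n) (Fin.suc x) with joinView n x
... | left i  = left (Fin.suc i)
... | right j = right j

++-elim : ∀ (P : Subset (n + m) → Set) → (∀ τ₁ τ₂ → P (τ₁ ++ τ₂)) → ∀ ρ → P ρ
++-elim {n} P P-++ ρ = subst P (Vec.take++drop≡id n ρ) (P-++ (take n ρ) (drop n ρ))

∈-++ˡ : ∀ (S₁ : Subset n) (S₂ : Subset m) {i} → i ↑ˡ m ∈ S₁ ++ S₂ → i ∈ S₁
∈-++ˡ S₁ S₂ {i} i∈S = Vec.lookup⇒[]= i S₁ (trans (sym (Vec.lookup-++ˡ S₁ S₂ i)) (Vec.[]=⇒lookup i∈S))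

∈-++ʳ : ∀ (S₁ : Subset n) (S₂ : Subset m) {j} → n ↑ʳ j ∈ S₁ ++ S₂ → j ∈ S₂
∈-++ʳ S₁ S₂ {j} j∈S = Vec.lookup⇒[]= j S₂ (trans (sym (Vec.lookup-++ʳ S₁ S₂ j)) (Vec.[]=⇒lookup j∈S))

∈-++ˡ⁺ : ∀ (S₁ : Subset n) (S₂ : Subset m) {i} → i ∈ S₁ → i ↑ˡ m ∈ S₁ ++ S₂
∈-++ˡ⁺ S₁ S₂ {i} i∈S₁ =
  Vec.lookup⇒[]= (i ↑ˡ _) (S₁ ++ S₂) (trans (Vec.lookup-++ˡ S₁ S₂ i) (Vec.[]=⇒lookup i∈S₁))

∈-++ʳ⁺ : ∀ (S₁ : Subset n) (S₂ : Subset m) {j} → j ∈ S₂ → n ↑ʳ j ∈ S₁ ++ S₂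
∈-++ʳ⁺ S₁ S₂ {j} j∈S₂ =
  Vec.lookup⇒[]= (_ ↑ʳ j) (S₁ ++ S₂) (trans (Vec.lookup-++ʳ S₁ S₂ j) (Vec.[]=⇒lookup j∈S₂))

⊆-++⁻ : ∀ {S₁ τ₁ : Subset n} {S₂ τ₂ : Subset m} → S₁ ++ S₂ ⊆ τ₁ ++ τ₂ → S₁ ⊆ τ₁ × S₂ ⊆ τ₂
⊆-++⁻ {S₁ = S₁} {τ₁} {S₂} {τ₂} S⊆τ =
  (λ i∈S₁ → ∈-++ˡ τ₁ τ₂ (S⊆τ (∈-++ˡ⁺ S₁ S₂ i∈S₁))) ,
  (λ j∈S₂ → ∈-++ʳ τ₁ τ₂ (S⊆τ (∈-++ʳ⁺ S₁ S₂ j∈S₂)))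

⊆-++⁺ : ∀ {S₁ τ₁ : Subset n} {S₂ τ₂ : Subset m} → S₁ ⊆ τ₁ → S₂ ⊆ τ₂ → S₁ ++ S₂ ⊆ τ₁ ++ τ₂
⊆-++⁺ {n} {S₁ = S₁} {τ₁} {S₂} {τ₂} S₁⊆τ₁ S₂⊆τ₂ {x} x∈S with joinView n x
... | left i  = ∈-++ˡ⁺ τ₁ τ₂ (S₁⊆τ₁ (∈-++ˡ S₁ S₂ x∈S))
... | right j = ∈-++ʳ⁺ τ₁ τ₂ (S₂⊆τ₂ (∈-++ʳ S₁ S₂ x∈S))

∣++∣ : ∀ (S₁ : Subset n) (S₂ : Subset m) → ∣ S₁ ++ S₂ ∣ ≡ ∣ S₁ ∣ + ∣ S₂ ∣
∣++∣ Vec.[]       S₂ = refl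
∣++∣ (true  ∷ S₁) S₂ = cong suc (∣++∣ S₁ S₂)
∣++∣ (false ∷ S₁) S₂ = ∣++∣ S₁ S₂

data _⊕_ (G : Graph n) (H : Graph m) : Graph (n + m) where
  edgeˡ : ∀ {i j} → G i j → (G ⊕ H) (i ↑ˡ m) (j ↑ˡ m)
  edgeʳ : ∀ {i j} → H i j → (G ⊕ H) (n ↑ʳ i) (n ↑ʳ j)

infix 4 α[_]≤_

α[_]≤_ : Graph n → ℕ → Set
α[ G ]≤ a = ∀ S → Independent G S → ∣ S ∣ ≤ a

α-mono : ∀ {G H : Graph n} {a} → (∀ x y → G x y → H x y) → α[ G ]≤ a → α[ H ]≤ a
α-mono G⊆H αG S indepH = αG S (λ x y x∈S y∈S → indepH x y x∈S y∈S ∘ G⊆H x y)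

I-mono : ∀ {G H : Graph n} {a U} → (∀ x y → G x y → H x y) → I a G U → I a H U
I-mono G⊆H IG S S⊆U indepH = IG S S⊆U (λ x y x∈S y∈S → indepH x y x∈S y∈S ∘ G⊆H x y)

I-zero : ∀ {G : Graph n} {U} → ¬ I 0 G U
I-zero I0 with () ← I0 ⊥ (λ x∈⊥ → ⊥-elim (∉⊥ x∈⊥)) (λ _ _ x∈⊥ _ _ → ∉⊥ x∈⊥)

module _ {G : Graph n} {H : Graph m} where

  independent-++⁻ : ∀ {S₁ S₂} → Independent (G ⊕ H) (S₁ ++ S₂) → Independent G S₁ × Independent H S₂
  independent-++⁻ {S₁} {S₂} indep =
    (λ i j i∈S₁ j∈S₁ → indep _ _ (∈-++ˡ⁺ S₁ S₂ i∈S₁) (∈-++ˡ⁺ S₁ S₂ j∈S₁) ∘′ edgeˡ) ,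
    (λ i j i∈S₂ j∈S₂ → indep _ _ (∈-++ʳ⁺ S₁ S₂ i∈S₂) (∈-++ʳ⁺ S₁ S₂ j∈S₂) ∘′ edgeʳ)

  independent-++⁺ : ∀ {S₁ S₂} → Independent G S₁ → Independent H S₂ → Independent (G ⊕ H) (S₁ ++ S₂)
  independent-++⁺ {S₁} {S₂} indep₁ _ _ _ x∈S y∈S (edgeˡ e) = indep₁ _ _ (∈-++ˡ S₁ S₂ x∈S) (∈-++ˡ S₁ S₂ y∈S) e
  independent-++⁺ {S₁} {S₂} _ indep₂ _ _ x∈S y∈S (edgeʳ e) = indep₂ _ _ (∈-++ʳ S₁ S₂ x∈S) (∈-++ʳ S₁ S₂ y∈S) e

  α-⊕ : ∀ {a b} → α[ G ]≤ a → α[ H ]≤ b → α[ G ⊕ H ]≤ a + b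
  α-⊕ {a} {b} αG αH = ++-elim (λ S → Independent (G ⊕ H) S → ∣ S ∣ ≤ a + b) λ S₁ S₂ indep →
    let indep₁ , indep₂ = independent-++⁻ indep in
    subst (_≤ a + b) (sym (∣++∣ S₁ S₂)) (+-mono-≤ (αG S₁ indep₁) (αH S₂ indep₂))

  I-⊕ˡ : ∀ {a b τ₁ τ₂} → I a G τ₁ → α[ H ]≤ b → I (a + b) (G ⊕ H) (τ₁ ++ τ₂)
  I-⊕ˡ {a} {b} {τ₁} {τ₂} Iτ₁ αH = ++-elim (λ S → S ⊆ τ₁ ++ τ₂ → Independent (G ⊕ H) S → ∣ S ∣ < a + b)
    λ S₁ S₂ S⊆τ indep → let indep₁ , indep₂ = independent-++⁻ indep in
    subst (_< a + b) (sym (∣++∣ S₁ S₂)) (+-mono-<-≤ (Iτ₁ S₁ (proj₁ (⊆-++⁻ S⊆τ)) indep₁) (αH S₂ indep₂))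

  I-⊕ʳ : ∀ {a b τ₁ τ₂} → α[ G ]≤ a → I b H τ₂ → I (a + b) (G ⊕ H) (τ₁ ++ τ₂)
  I-⊕ʳ {a} {b} {τ₁} {τ₂} αG Iτ₂ = ++-elim (λ S → S ⊆ τ₁ ++ τ₂ → Independent (G ⊕ H) S → ∣ S ∣ < a + b)
    λ S₁ S₂ S⊆τ indep → let indep₁ , indep₂ = independent-++⁻ indep in
    subst (_< a + b) (sym (∣++∣ S₁ S₂)) (+-mono-≤-< (αG S₁ indep₁) (Iτ₂ S₂ (proj₂ (⊆-++⁻ S⊆τ)) indep₂))

  I-⊕-cancel : ∀ {b τ₁ τ₂} M → Independent G M → M ⊆ τ₁ →
               I (∣ M ∣ + b) (G ⊕ H) (τ₁ ++ τ₂) → I b H τ₂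
  I-⊕-cancel {b} M indepM M⊆τ₁ Iτ S S⊆τ₂ indepS = +-cancelˡ-< ∣ M ∣ ∣ S ∣ b
    (subst (_< _) (∣++∣ M S) (Iτ (M ++ S) (⊆-++⁺ M⊆τ₁ S⊆τ₂) (independent-++⁺ indepM indepS)))

-- Enumerating independent sets

independent? : (G : Graph n) → (∀ i j → Dec (G i j)) → ∀ S → Dec (Independent G S)
independent? G G? S = all? λ x → all? λ y → x ∈? S →-dec y ∈? S →-dec ¬? (G? x y)

private
  dropZero : Graph (suc n) → Graph n
  dropZero G i j = G (Fin.suc i) (Fin.suc j)

  Extends : Graph (suc n) → Subset n → Set
  Extends G S = ¬ G Fin.zero Fin.zero × (∀ y → y ∈ S → ¬ G Fin.zero (Fin.suc y) × ¬ G (Fin.suc y) Fin.zero)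

  extends? : (G : Graph (suc n)) → (∀ i j → Dec (G i j)) → ∀ S → Dec (Extends G S)
  extends? G G? S = ¬? (G? Fin.zero Fin.zero) ×-dec
    all? (λ y → y ∈? S →-dec (¬? (G? Fin.zero (Fin.suc y)) ×-dec ¬? (G? (Fin.suc y) Fin.zero)))

  extensions : (G : Graph (suc n)) → (∀ i j → Dec (G i j)) → Subset n → List (Subset (suc n))
  extensions G G? S = (outside ∷ S) ∷ (if does (extends? G G? S) then (inside ∷ S) ∷ [] else [])

-- Each list of independent sets of dropZero G is traversed only once, which
-- keeps its normalisation linear in the number of independent sets.
independentSets : (G : Graph n) → (∀ i j → Dec (G i j)) → List (Subset n)
independentSets {zero}  G G? = Vec.[] ∷ []
independentSets {suc n} G G? =
  concatMap (extensions G G?) (independentSets (dropZero G) (λ i j → G? (Fin.suc i) (Fin.suc j)))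

∈-independentSets : ∀ (G : Graph n) G? S → Independent G S → S ∈ₗ independentSets G G?
∈-independentSets {zero}  G G? Vec.[]  _     = here refl
∈-independentSets {suc n} G G? (b ∷ S) indep =
  ∈-concatMap⁺ (extensions G G?) (Any.map (λ { refl → ∈-extensions b indep }) S∈rest)
  where
  S∈rest : S ∈ₗ independentSets (dropZero G) (λ i j → G? (Fin.suc i) (Fin.suc j))
  S∈rest = ∈-independentSets (dropZero G) _ S (λ x y x∈S y∈S → indep _ _ (Vec.there x∈S) (Vec.there y∈S))
  ∈-extensions : ∀ b → Independent G (b ∷ S) → (b ∷ S) ∈ₗ extensions G G? S
  ∈-extensions outside _ = here refl
  ∈-extensions inside indep
    rewrite dec-true (extends? G G? S)
                     (indep _ _ Vec.here Vec.here , λ y y∈S → indep _ _ Vec.here (Vec.there y∈S) , indep _ _ (Vec.there y∈S) Vec.here)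
    = there (here refl)

Dodeca : Graph 20
Dodeca i j = DodecaAdj (toℕ i) (toℕ j)

module _ (k : ℕ) where

  private
    /20-↑ˡ : ∀ (i : Fin 20) → toℕ (i ↑ˡ (k * 20)) / 20 ≡ 0
    /20-↑ˡ i = trans (cong (_/ 20) (toℕ-↑ˡ i (k * 20))) (m<n⇒m/n≡0 (toℕ<n i))

    %20-↑ˡ : ∀ (i : Fin 20) → toℕ (i ↑ˡ (k * 20)) % 20 ≡ toℕ i
    %20-↑ˡ i = trans (cong (_% 20) (toℕ-↑ˡ i (k * 20))) (m<n⇒m%n≡m (toℕ<n i))

    /20-↑ʳ : ∀ (j : Fin (k * 20)) → toℕ (20 ↑ʳ j) / 20 ≡ suc (toℕ j / 20)
    /20-↑ʳ j = trans (cong (_/ 20) (toℕ-↑ʳ 20 j)) (m/n≡1+[m∸n]/n (m≤m+n 20 (toℕ j)))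

    %20-↑ʳ : ∀ (j : Fin (k * 20)) → toℕ (20 ↑ʳ j) % 20 ≡ toℕ j % 20
    %20-↑ʳ j = trans (cong (_% 20) (trans (toℕ-↑ʳ 20 j) (+-comm 20 (toℕ j)))) ([m+n]%n≡m%n (toℕ j) 20)

  Gk-suc⁻ : ∀ x y → (Dodeca ⊕ Gk k) x y → Gk (suc k) x y
  Gk-suc⁻ _ _ (edgeˡ {i} {j} e) =
    trans (/20-↑ˡ i) (sym (/20-↑ˡ j)) , subst₂ DodecaAdj (sym (%20-↑ˡ i)) (sym (%20-↑ˡ j)) e
  Gk-suc⁻ _ _ (edgeʳ {i} {j} (same-copy , e)) =
    trans (/20-↑ʳ i) (trans (cong suc same-copy) (sym (/20-↑ʳ j))) , subst₂ DodecaAdj (sym (%20-↑ʳ i)) (sym (%20-↑ʳ j)) e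

  Gk-suc⁺ : ∀ x y → Gk (suc k) x y → (Dodeca ⊕ Gk k) x y
  Gk-suc⁺ x y (same-copy , e) with joinView 20 x | joinView 20 y
  ... | left i  | left j  = edgeˡ (subst₂ DodecaAdj (%20-↑ˡ i) (%20-↑ˡ j) e)
  ... | right i | right j = edgeʳ (suc-injective (trans (sym (/20-↑ʳ i)) (trans same-copy (/20-↑ʳ j))) ,
                                   subst₂ DodecaAdj (%20-↑ʳ i) (%20-↑ʳ j) e)
  ... | left i  | right j = ⊥-elim (0≢1+n (trans (sym (/20-↑ˡ i)) (trans same-copy (/20-↑ʳ j))))
  ... | right i | left j  = ⊥-elim (0≢1+n (trans (sym (/20-↑ˡ j)) (trans (sym same-copy) (/20-↑ʳ i))))

dodecaEdge? : ∀ p q → Dec (DodecaEdge p q)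
dodecaEdge? p q = map′ toEdge fromEdge
  ((p <? 10 ×-dec (q ≟ 10 + p ⊎-dec q ≟ suc p % 10)) ⊎-dec (10 ≤? p ×-dec p <? 20 ×-dec q ≟ 10 + (2 + (p ∸ 10)) % 10))
  where
  Edge : Set
  Edge = (p < 10 × (q ≡ 10 + p ⊎ q ≡ suc p % 10)) ⊎ (10 ≤ p × p < 20 × q ≡ 10 + (2 + (p ∸ 10)) % 10)
  toEdge : Edge → DodecaEdge p q
  toEdge (inj₁ (p<10 , inj₁ refl))   = spoke p p<10
  toEdge (inj₁ (p<10 , inj₂ refl))   = outer p p<10
  toEdge (inj₂ (10≤p , p<20 , refl)) = subst (λ p → DodecaEdge p (10 + (2 + (p ∸ 10)) % 10)) (m+[n∸m]≡n 10≤p)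
                                             (inner (p ∸ 10) (∸-monoˡ-< p<20 10≤p))
  fromEdge : DodecaEdge p q → Edge
  fromEdge (spoke j j<10) = inj₁ (j<10 , inj₁ refl)
  fromEdge (outer j j<10) = inj₁ (j<10 , inj₂ refl)
  fromEdge (inner j j<10) = inj₂ (m≤m+n 10 j , +-monoʳ-< 10 j<10 , refl)

dodeca? : ∀ i j → Dec (Dodeca i j)
dodeca? i j = map′ [ fwd , bwd ]′ (λ { (fwd e) → inj₁ e ; (bwd e) → inj₂ e })
                   (dodecaEdge? (toℕ i) (toℕ j) ⊎-dec dodecaEdge? (toℕ j) (toℕ i))

vertices : List ℕ → Subset n
vertices xs = Vec.tabulate (λ i → any (toℕ i ℕ.≡ᵇ_) xs)

maximumIndependentSets : List (Subset 20)
maximumIndependentSets =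
  vertices (0 ∷ 2 ∷ 5 ∷ 7 ∷ 13 ∷ 14 ∷ 18 ∷ 19 ∷ []) ∷
  vertices (0 ∷ 3 ∷ 5 ∷ 8 ∷ 11 ∷ 12 ∷ 16 ∷ 17 ∷ []) ∷
  vertices (1 ∷ 3 ∷ 6 ∷ 8 ∷ 10 ∷ 14 ∷ 15 ∷ 19 ∷ []) ∷
  vertices (1 ∷ 4 ∷ 6 ∷ 9 ∷ 12 ∷ 13 ∷ 17 ∷ 18 ∷ []) ∷
  vertices (2 ∷ 4 ∷ 7 ∷ 9 ∷ 10 ∷ 11 ∷ 15 ∷ 16 ∷ []) ∷ []

maximumIndependentSets-independent : All (Independent Dodeca) maximumIndependentSets
maximumIndependentSets-independent = from-yes (All.all? (independent? Dodeca dodeca?) maximumIndependentSets)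

maximumIndependentSets-size : All (λ M → ∣ M ∣ ≡ 8) maximumIndependentSets
maximumIndependentSets-size = from-yes (All.all? (λ M → ∣ M ∣ ≟ 8) maximumIndependentSets)

private
  maximum? : ∀ S → Dec (S ∈ₗ maximumIndependentSets)
  maximum? S = member? (Vec.≡-dec Bool._≟_) S maximumIndependentSets

  small-or-maximum : All (λ S → ∣ S ∣ ≤ 7 ⊎ S ∈ₗ maximumIndependentSets) (independentSets Dodeca dodeca?)
  small-or-maximum = from-yes (All.all? (λ S → ∣ S ∣ ≤? 7 ⊎-dec maximum? S) (independentSets Dodeca dodeca?))

-- Its users eliminate it with [_,_]′: a `with` over it makes Agda normalise
-- the whole enumeration.
independent-small-or-maximum : ∀ S → Independent Dodeca S → ∣ S ∣ ≤ 7 ⊎ S ∈ₗ maximumIndependentSets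
independent-small-or-maximum S indep = All.lookup small-or-maximum (∈-independentSets Dodeca dodeca? S indep)

α-dodeca : α[ Dodeca ]≤ 8
α-dodeca S indep = [ m≤n⇒m≤1+n , ≤-reflexive ∘ All.lookup maximumIndependentSets-size ]′
  (independent-small-or-maximum S indep)

NoMaximumIndependentSetIn : Subset 20 → Set
NoMaximumIndependentSetIn τ = All (λ M → ¬ M ⊆ τ) maximumIndependentSets

I-dodeca : ∀ {τ} → NoMaximumIndependentSetIn τ → I 8 Dodeca τ
I-dodeca noMax S S⊆τ indep = [ s≤s , (λ S∈max → ⊥-elim (All.lookup noMax S∈max S⊆τ)) ]′
  (independent-small-or-maximum S indep)

-- A relative cycle of the dodecahedron modulo I 8 Dodeca

coefficient : List (Subset n × ℚ) → Chain n
coefficient []             ρ = 0ℚ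
coefficient ((σ , q) ∷ ts) ρ = if does (Vec.≡-dec Bool._≟_ ρ σ) then q else coefficient ts ρ

coefficient-support : ∀ (ts : List (Subset n × ℚ)) ρ → coefficient ts ρ ≢ 0ℚ → ∃[ q ] (ρ , q) ∈ₗ ts
coefficient-support []             ρ ≢0 = ⊥-elim (≢0 refl)
coefficient-support ((σ , q) ∷ ts) ρ ≢0 with Vec.≡-dec Bool._≟_ ρ σ
... | yes refl = q , here refl
... | no  _    = let q′ , ∈ts = coefficient-support ts ρ ≢0 in q′ , there ∈ts

allBut : List ℕ → Subset n
allBut = ∁ ∘ vertices

-- Each face of ψ is given by the three vertices it misses.
ψ-terms : List (Subset 20 × ℚ)
ψ-terms =
  (allBut (9 ∷ 15 ∷ 17 ∷ []) , 1ℚ) ∷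
  (allBut (6 ∷ 15 ∷ 17 ∷ []) , - 1ℚ) ∷
  (allBut (4 ∷ 15 ∷ 17 ∷ []) , - 1ℚ) ∷
  (allBut (1 ∷ 15 ∷ 17 ∷ []) , 1ℚ) ∷
  (allBut (9 ∷ 10 ∷ 17 ∷ []) , - 1ℚ) ∷
  (allBut (6 ∷ 10 ∷ 17 ∷ []) , 1ℚ) ∷
  (allBut (4 ∷ 10 ∷ 17 ∷ []) , 1ℚ) ∷
  (allBut (1 ∷ 10 ∷ 17 ∷ []) , - 1ℚ) ∷
  (allBut (9 ∷ 15 ∷ 16 ∷ []) , - 1ℚ) ∷
  (allBut (6 ∷ 15 ∷ 16 ∷ []) , 1ℚ) ∷
  (allBut (4 ∷ 15 ∷ 16 ∷ []) , 1ℚ) ∷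
  (allBut (1 ∷ 15 ∷ 16 ∷ []) , - 1ℚ) ∷
  (allBut (9 ∷ 10 ∷ 16 ∷ []) , 1ℚ) ∷
  (allBut (6 ∷ 10 ∷ 16 ∷ []) , - 1ℚ) ∷
  (allBut (4 ∷ 10 ∷ 16 ∷ []) , - 1ℚ) ∷
  (allBut (1 ∷ 10 ∷ 16 ∷ []) , 1ℚ) ∷
  (allBut (9 ∷ 12 ∷ 15 ∷ []) , 1ℚ) ∷
  (allBut (6 ∷ 12 ∷ 15 ∷ []) , - 1ℚ) ∷
  (allBut (4 ∷ 12 ∷ 15 ∷ []) , - 1ℚ) ∷
  (allBut (1 ∷ 12 ∷ 15 ∷ []) , 1ℚ) ∷
  (allBut (9 ∷ 11 ∷ 15 ∷ []) , - 1ℚ) ∷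
  (allBut (6 ∷ 11 ∷ 15 ∷ []) , 1ℚ) ∷
  (allBut (4 ∷ 11 ∷ 15 ∷ []) , 1ℚ) ∷
  (allBut (1 ∷ 11 ∷ 15 ∷ []) , - 1ℚ) ∷
  (allBut (8 ∷ 9 ∷ 15 ∷ []) , - 1ℚ) ∷
  (allBut (3 ∷ 9 ∷ 15 ∷ []) , 1ℚ) ∷
  (allBut (6 ∷ 8 ∷ 15 ∷ []) , - 1ℚ) ∷
  (allBut (4 ∷ 8 ∷ 15 ∷ []) , - 1ℚ) ∷
  (allBut (1 ∷ 8 ∷ 15 ∷ []) , 1ℚ) ∷
  (allBut (3 ∷ 6 ∷ 15 ∷ []) , - 1ℚ) ∷
  (allBut (3 ∷ 4 ∷ 15 ∷ []) , - 1ℚ) ∷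
  (allBut (1 ∷ 3 ∷ 15 ∷ []) , - 1ℚ) ∷
  (allBut (9 ∷ 10 ∷ 12 ∷ []) , 1ℚ) ∷
  (allBut (6 ∷ 10 ∷ 12 ∷ []) , - 1ℚ) ∷
  (allBut (4 ∷ 10 ∷ 12 ∷ []) , - 1ℚ) ∷
  (allBut (1 ∷ 10 ∷ 12 ∷ []) , 1ℚ) ∷
  (allBut (9 ∷ 10 ∷ 11 ∷ []) , - 1ℚ) ∷
  (allBut (6 ∷ 10 ∷ 11 ∷ []) , 1ℚ) ∷
  (allBut (4 ∷ 10 ∷ 11 ∷ []) , 1ℚ) ∷
  (allBut (1 ∷ 10 ∷ 11 ∷ []) , - 1ℚ) ∷
  (allBut (8 ∷ 9 ∷ 10 ∷ []) , 1ℚ) ∷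
  (allBut (3 ∷ 9 ∷ 10 ∷ []) , - 1ℚ) ∷
  (allBut (6 ∷ 8 ∷ 10 ∷ []) , 1ℚ) ∷
  (allBut (4 ∷ 8 ∷ 10 ∷ []) , 1ℚ) ∷
  (allBut (1 ∷ 8 ∷ 10 ∷ []) , - 1ℚ) ∷
  (allBut (3 ∷ 6 ∷ 10 ∷ []) , 1ℚ) ∷
  (allBut (3 ∷ 4 ∷ 10 ∷ []) , 1ℚ) ∷
  (allBut (1 ∷ 3 ∷ 10 ∷ []) , 1ℚ) ∷
  []
ψ : Chain 20
ψ = coefficient ψ-terms

σ₀ : Subset 20
σ₀ = allBut (2 ∷ 4 ∷ 10 ∷ 11 ∷ [])

private
  ψ-faces : All (λ t → ∣ proj₁ t ∣ ≡ 17) ψ-terms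
  ψ-faces = from-yes (All.all? (λ t → ∣ proj₁ t ∣ ≟ 17) ψ-terms)

  noMaximum? : ∀ τ → Dec (NoMaximumIndependentSetIn τ)
  noMaximum? τ = All.all? (λ M → ¬? (M ⊆? τ)) maximumIndependentSets

  ∂ψ-faces : All (λ t → ∀ v → v ∈ proj₁ t →
                        NoMaximumIndependentSetIn (proj₁ t ─ ⁅ v ⁆) ⊎ ∂ ψ (proj₁ t ─ ⁅ v ⁆) ≡ 0ℚ) ψ-terms
  ∂ψ-faces = from-yes (All.all? (λ t → all? λ v → v ∈? proj₁ t →-dec
                                   (noMaximum? (proj₁ t ─ ⁅ v ⁆) ⊎-dec ∂ ψ (proj₁ t ─ ⁅ v ⁆) ℚP.≟ 0ℚ)) ψ-terms)

ψ-support : ∀ ρ → ψ ρ ≢ 0ℚ → ∣ ρ ∣ ≡ 17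
ψ-support ρ ψρ≢0 = let _ , ∈ψ = coefficient-support ψ-terms ρ ψρ≢0 in All.lookup ψ-faces ∈ψ

∂ψ-support : ∀ τ → ∂ ψ τ ≢ 0ℚ → ∣ τ ∣ ≡ 16 × I 8 Dodeca τ
∂ψ-support τ ∂ψτ≢0 =
  let v , v∉τ , ψ≢0 = ∂-support ψ τ ∂ψτ≢0
      _ , ∈ψ = coefficient-support ψ-terms (τ ∪ ⁅ v ⁆) ψ≢0
      τ∪v─v≡τ = ∪⁅⁆-─⁅⁆ τ v v∉τ
  in suc-injective (trans (sym (∣∪⁅⁆∣ τ v v∉τ)) (All.lookup ψ-faces ∈ψ)) ,
     I-dodeca ([ subst NoMaximumIndependentSetIn τ∪v─v≡τ
               , (λ ∂ψ≡0 → ⊥-elim (∂ψτ≢0 (subst (λ σ → ∂ ψ σ ≡ 0ℚ) τ∪v─v≡τ ∂ψ≡0))) ]′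
                 (All.lookup ∂ψ-faces ∈ψ v (x∈p∪q⁺ (inj₂ (x∈⁅x⁆ v)))))

∂ψ-σ₀ : ∂ ψ σ₀ ≡ 1ℚ
∂ψ-σ₀ = refl

σ₀-saturated : ∀ v → lookup σ₀ v ≡ false → Any (_⊆ σ₀ ∪ ⁅ v ⁆) maximumIndependentSets
σ₀-saturated = from-yes (all? λ v → lookup σ₀ v Bool.≟ false →-dec Any.any? (_⊆? σ₀ ∪ ⁅ v ⁆) maximumIndependentSets)

-- Joins of copies of ψ

Supported : (Subset n → Set) → Chain n → Set
Supported X c = ∀ σ → c σ ≢ 0ℚ → X σ

infix 30 ψ^_

ψ^_ : ∀ k → Chain (k * 20)
ψ^ zero    = λ _ → 1ℚ
ψ^ (suc k) = ψ ⊗ ψ^ k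

α-Gk : ∀ k → α[ Gk k ]≤ 8 * k
α-Gk zero    Vec.[] _ = z≤n
α-Gk (suc k)          = subst (α[ Gk (suc k) ]≤_) (sym (*-suc 8 k)) (α-mono (Gk-suc⁻ k) (α-⊕ α-dodeca (α-Gk k)))

I-Gk-suc⁺ : ∀ k {U} → I (8 + 8 * k) (Dodeca ⊕ Gk k) U → I (8 * suc k) (Gk (suc k)) U
I-Gk-suc⁺ k {U} = subst (λ a → I a (Gk (suc k)) U) (sym (*-suc 8 k)) ∘ I-mono (Gk-suc⁻ k)

I-Gk-suc⁻ : ∀ k {U} → I (8 * suc k) (Gk (suc k)) U → I (8 + 8 * k) (Dodeca ⊕ Gk k) U
I-Gk-suc⁻ k {U} = I-mono (Gk-suc⁺ k) ∘ subst (λ a → I a (Gk (suc k)) U) (*-suc 8 k)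

ψ^-support : ∀ k ρ → (ψ^ k) ρ ≢ 0ℚ → ∣ ρ ∣ ≡ 17 * k
ψ^-support zero    Vec.[] _ = refl
ψ^-support (suc k) = ++-elim (λ ρ → (ψ^ suc k) ρ ≢ 0ℚ → ∣ ρ ∣ ≡ 17 * suc k) λ τ₁ τ₂ ψ^≢0 →
  let ψ≢0 , ψ^k≢0 = ⊗-support ψ (ψ^ k) τ₁ τ₂ ψ^≢0 in
  trans (∣++∣ τ₁ τ₂) (trans (cong₂ _+_ (ψ-support τ₁ ψ≢0) (ψ^-support k τ₂ ψ^k≢0)) (sym (*-suc 17 k)))

∂ψ^-support : ∀ k ρ → ∂ (ψ^ k) ρ ≢ 0ℚ → I (8 * k) (Gk k) ρ × suc ∣ ρ ∣ ≡ 17 * k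
∂ψ^-support zero    ρ ∂≢0 = ⊥-elim (∂≢0 refl)
∂ψ^-support (suc k) = ++-elim (λ ρ → ∂ (ψ^ suc k) ρ ≢ 0ℚ → I (8 * suc k) (Gk (suc k)) ρ × suc ∣ ρ ∣ ≡ 17 * suc k)
  λ τ₁ τ₂ ∂≢0 → by-cases τ₁ τ₂ (∂-⊗-support ψ (ψ^ k) τ₁ τ₂ ∂≢0)
  where
  by-cases : ∀ τ₁ τ₂ → (∂ ψ τ₁ ≢ 0ℚ × (ψ^ k) τ₂ ≢ 0ℚ) ⊎ (ψ τ₁ ≢ 0ℚ × ∂ (ψ^ k) τ₂ ≢ 0ℚ) →
             I (8 * suc k) (Gk (suc k)) (τ₁ ++ τ₂) × suc ∣ τ₁ ++ τ₂ ∣ ≡ 17 * suc k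
  by-cases τ₁ τ₂ (inj₁ (∂ψ≢0 , ψ^k≢0)) = let ∣τ₁∣≡16 , Iτ₁ = ∂ψ-support τ₁ ∂ψ≢0 in
    I-Gk-suc⁺ k (I-⊕ˡ Iτ₁ (α-Gk k)) ,
    trans (cong suc (trans (∣++∣ τ₁ τ₂) (cong₂ _+_ ∣τ₁∣≡16 (ψ^-support k τ₂ ψ^k≢0)))) (sym (*-suc 17 k))
  by-cases τ₁ τ₂ (inj₂ (ψ≢0 , ∂ψ^k≢0)) = let Iτ₂ , ∣τ₂∣ = ∂ψ^-support k τ₂ ∂ψ^k≢0 in
    I-Gk-suc⁺ k (I-⊕ʳ α-dodeca Iτ₂) ,
    trans (cong suc (trans (∣++∣ τ₁ τ₂) (cong (_+ ∣ τ₂ ∣) (ψ-support τ₁ ψ≢0))))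
          (trans (cong (17 +_) ∣τ₂∣) (sym (*-suc 17 k)))

∂ψ^-isChain : ∀ k → IsChain (I (8 * suc k) (Gk (suc k))) ⊤ (15 + 17 * k) (∂ (ψ^ suc k))
∂ψ^-isChain k σ ∂≢0 = let Iσ , ∣σ∣ = ∂ψ^-support (suc k) σ ∂≢0 in
  Iσ , ⊆⊤ , suc-injective (trans ∣σ∣ (*-suc 17 k))

I-coface-σ₀ : ∀ k v ρ → lookup σ₀ v ≡ false → I (8 * suc k) (Gk (suc k)) ((σ₀ ∪ ⁅ v ⁆) ++ ρ) → I (8 * k) (Gk k) ρ
I-coface-σ₀ k v ρ v∉σ₀ I-coface =
  let M , M∈ , M⊆ = find (σ₀-saturated v v∉σ₀) in
  I-⊕-cancel M (All.lookup maximumIndependentSets-independent M∈) M⊆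
    (subst (λ a → I (a + 8 * k) (Dodeca ⊕ Gk k) ((σ₀ ∪ ⁅ v ⁆) ++ ρ)) (sym (All.lookup maximumIndependentSets-size M∈))
           (I-Gk-suc⁻ k I-coface))

slice-supported : ∀ k {b} → Supported (I (8 * suc k) (Gk (suc k))) b → Supported (I (8 * k) (Gk k)) (slice σ₀ b)
slice-supported k {b} supported ρ slice≢0 =
  let v , v∉σ₀ , b≢0 = slice-support σ₀ b ρ slice≢0 in
  I-coface-σ₀ k v ρ v∉σ₀ (supported ((σ₀ ∪ ⁅ v ⁆) ++ ρ) b≢0)

slice-ψ^ : ∀ k ρ → slice σ₀ (ψ^ suc k) ρ ≡ (ψ^ k) ρ
slice-ψ^ k ρ = trans (slice-⊗ σ₀ ψ (ψ^ k) ρ) (trans (cong (ℚ._* (ψ^ k) ρ) ∂ψ-σ₀) (ℚP.*-identityˡ ((ψ^ k) ρ)))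

-- The implicit chains are given explicitly: left to unification, Agda unfolds ψ^ and ψ.
∂ψ^-not-boundary : ∀ k (b : Chain (suc k * 20)) → Supported (I (8 * suc k) (Gk (suc k))) b →
                   ¬ (∀ τ → ∂ b τ ≡ ∂ (ψ^ suc k) τ)
∂ψ^-not-boundary zero b supported ∂b≗∂ψ^ = ℚP.1≢0 (begin
  1ℚ                       ≡⟨ slice-ψ^ 0 Vec.[] ⟨
  slice σ₀ (ψ^ 1) Vec.[]   ≡⟨ ∂-++-[] σ₀ (ψ^ 1) ⟨
  ∂ (ψ^ 1) (σ₀ ++ Vec.[])  ≡⟨ ∂b≗∂ψ^ (σ₀ ++ Vec.[]) ⟨
  ∂ b (σ₀ ++ Vec.[])       ≡⟨ ∂-++-[] σ₀ b ⟩
  slice σ₀ b Vec.[]        ≡⟨ decidable-stable (slice σ₀ b Vec.[] ℚP.≟ 0ℚ)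
                                               (I-zero ∘ slice-supported zero supported Vec.[]) ⟩
  0ℚ                       ∎)
  where open ≡-Reasoning
∂ψ^-not-boundary (suc k) b supported ∂b≗∂ψ^ =
  ∂ψ^-not-boundary k (slice σ₀ b) (slice-supported (suc k) supported) λ ρ → begin
    ∂ (slice σ₀ b) ρ                 ≡⟨ ∂-slice-cong σ₀ {b} {ψ^ suc (suc k)} ∂b≗∂ψ^ ρ ⟩
    ∂ (slice σ₀ (ψ^ suc (suc k))) ρ  ≡⟨ ∂-cong {c = slice σ₀ (ψ^ suc (suc k))} {d = ψ^ suc k} (slice-ψ^ (suc k)) ρ ⟩
    ∂ (ψ^ suc k) ρ                   ∎
  where open ≡-Reasoning

corollary7p5 : ∀ (k : ℕ) → 1 ≤ k → ∀ (d : ℕ) → IsLeray (I (8 * k) (Gk k)) d → 17 * k ∸ 1 ≤ d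
corollary7p5 (suc k) _ d leray = ≮⇒≥ λ d<17k+16 →
  let d≤17k+15 = s≤s⁻¹ (subst (d <_) (cong (_∸ 1) (*-suc 17 k)) d<17k+16)
      b , b-isChain , ∂b≗∂ψ^ = leray ⊤ (15 + 17 * k) d≤17k+15 (∂ (ψ^ suc k)) (∂ψ^-isChain k) (∂∂ (ψ^ suc k))
  in ∂ψ^-not-boundary k b (λ σ b≢0 → proj₁ (b-isChain σ b≢0)) ∂b≗∂ψ^
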